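{- For all positive integers $d\le n$, there exists a family $\mathcal{A}\subset 2^{[n]}$ satisfying $\mathrm{VC}(\mathcal{A}\cap\mathcal{A})\le d$, $\mathrm{VC}(\mathcal{A}\cup\mathcal{A})\le d$ and $|\mathcal{A}|>(n/d)^d$.
   Context: $[n]=\{1,\dots,n\}$. For a family $\mathcal{F}\subset 2^{[n]}$, a set $Y\subset[n]$ is shattered by $\mathcal{F}$ if $\{S\cap Y: S\in\mathcal{F}\}=2^Y$; $\mathrm{VC}(\mathcal{F})$ is the largest cardinality of a set shattered by $\mathcal{F}$. $\mathcal{A}\cap\mathcal{A}=\{S\cap T: S,T\in\mathcal{A}\}$ and $\mathcal{A}\cup\mathcal{A}=\{S\cup T: S,T\in\mathcal{A}\}$. -}

module Defs where

open import Data.Nat using (ℕ; _≤_)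
open import Data.Product using (Σ; _×_)
open import Data.List using (List)
open import Data.List.Membership.Propositional using (_∈_)
open import Data.Fin.Subset using (Subset; _∩_; _∪_; _⊆_; ∣_∣)
open import Relation.Binary.PropositionalEquality using (_≡_)

Family : ℕ → Set₁
Family n = Subset n → Set

members : ∀ {n} → List (Subset n) → Family n
members A S = S ∈ A

_∩∩_ : ∀ {n} → Family n → Family n → Family n
(F ∩∩ G) U = Σ _ λ S → Σ _ λ T → F S × G T × U ≡ S ∩ T

_∪∪_ : ∀ {n} → Family n → Family n → Family n
(F ∪∪ G) U = Σ _ λ S → Σ _ λ T → F S × G T × U ≡ S ∪ T

Shattered : ∀ {n} → Family n → Subset n → Set
Shattered F Y = ∀ T → T ⊆ Y → Σ _ λ S → F S × S ∩ Y ≡ T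

VC≤ : ∀ {n} → Family n → ℕ → Set
VC≤ F d = ∀ Y → Shattered F Y → ∣ Y ∣ ≤ d

module Submission where

-- Write n = d q + r with 0 ≤ r < d and view [n] as d blocks
-- of q coordinates followed by r padding coordinates.  On each block take the
-- chain of the q + 1 initial segments; let A be the product of these d chains,
-- extended by ∅ on the padding coordinates.
--
-- A chain is closed under ∩ and ∪ and shatters no two-element set, and the
-- product of families adds VC-dimensions while preserving closure under any
-- coordinatewise Boolean operation.  Hence A is a sublattice of 2^[n] with
-- VC(A) ≤ d, so A ∩ A = A ∪ A = A and both have VC-dimension at most d.
-- Finally |A| = (q + 1)^d and d^d (q + 1)^d = (d q + d)^d > (d q + r)^d = n^d.

open import Defs
open import Data.Nat using (ℕ; zero; suc; _+_; _*_; _^_; _≤_; _<_; z≤n; s≤s; NonZero)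
open import Data.Nat.Properties
  using (+-mono-≤; +-monoʳ-<; +-comm; *-comm; *-suc; +-identityʳ; *-identityʳ;
         ^-monoˡ-<; [m*n]*[o*p]≡[m*o]*[n*p]; ≤-reflexive)
open import Data.Nat.DivMod using (_/_; _%_; m≡m%n+[m/n]*n; m%n<n)
open import Data.Bool using (Bool; _∧_; _∨_)
open import Data.Product using (Σ; _×_; _,_; proj₁; proj₂)
open import Data.List using (List; []; _∷_; [_]; length; map; cartesianProductWith)
open import Data.List.Properties using (length-++; length-map)
open import Data.List.Membership.Propositional using (_∈_)
open import Data.List.Membership.Propositional.Properties
  using (∈-cartesianProductWith⁺; ∈-cartesianProductWith⁻; ∈-map⁺; ∈-map⁻)
open import Data.List.Relation.Unary.Any using (here; there)
open import Data.List.Relation.Unary.All as All using ([])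
open import Data.List.Relation.Unary.AllPairs using (_∷_; [])
open import Data.List.Relation.Unary.Unique.Propositional using (Unique)
import Data.List.Relation.Unary.Unique.Propositional.Properties as Unique
open import Data.Vec using (_++_; splitAt; zipWith) renaming ([] to []ᵥ; _∷_ to _∷ᵥ_)
import Data.Vec as Vec
open import Data.Vec.Properties using (∷-injectiveˡ; ∷-injectiveʳ; ++-injective; zipWith-++)
open import Data.Fin.Subset using (Subset; _∩_; _⊆_; ∣_∣; ⊥; inside; outside)
open import Data.Fin.Subset.Properties
  using (⊆-refl; ⊥⊆; ∣⊥∣≡0; out⊆; s⊆s; drop-∷-⊆; ∩-zeroˡ; ∩-zeroʳ; ∪-identityˡ; ∪-identityʳ; ∩-idem; ∪-idem)
open import Relation.Binary.PropositionalEquality using (_≡_; _≢_; refl; sym; trans; cong; cong₂; subst; module ≡-Reasoning)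

vc-mono : ∀ {n} {F G : Family n} {d} → (∀ {S} → F S → G S) → VC≤ G d → VC≤ F d
vc-mono F⊆G vcG Y shF = vcG Y λ T T⊆Y →
  let (S , S∈F , trace) = shF T T⊆Y in S , F⊆G S∈F , trace

ClosedUnder : ∀ {n} → (Bool → Bool → Bool) → List (Subset n) → Set
ClosedUnder f A = ∀ {S T} → S ∈ A → T ∈ A → zipWith f S T ∈ A

∩∩-⊆ : ∀ {n} {A : List (Subset n)} → ClosedUnder _∧_ A →
       ∀ {U} → (members A ∩∩ members A) U → members A U
∩∩-⊆ closed (_ , _ , S∈A , T∈A , refl) = closed S∈A T∈A

∪∪-⊆ : ∀ {n} {A : List (Subset n)} → ClosedUnder _∨_ A →
       ∀ {U} → (members A ∪∪ members A) U → members A U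
∪∪-⊆ closed (_ , _ , S∈A , T∈A , refl) = closed S∈A T∈A

record VCSublattice {n} (A : List (Subset n)) (d : ℕ) : Set where
  field
    unique   : Unique A
    closed∩  : ClosedUnder _∧_ A
    closed∪  : ClosedUnder _∨_ A
    vc       : VC≤ (members A) d

  vc-∩∩ : VC≤ (members A ∩∩ members A) d
  vc-∩∩ = vc-mono (∩∩-⊆ closed∩) vc

  vc-∪∪ : VC≤ (members A ∪∪ members A) d
  vc-∪∪ = vc-mono (∪∪-⊆ closed∪) vc

open VCSublattice

_⊗_ : ∀ {a b} → List (Subset a) → List (Subset b) → List (Subset (a + b))
A ⊗ B = cartesianProductWith _++_ A B

length-⊗ : ∀ {a b} (A : List (Subset a)) (B : List (Subset b)) →
           length (A ⊗ B) ≡ length A * length B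
length-⊗ []      B = refl
length-⊗ (S ∷ A) B = trans (length-++ (map (S ++_) B))
  (cong₂ _+_ (length-map (S ++_) B) (length-⊗ A B))

unique-⊗ : ∀ {a b} {A : List (Subset a)} {B : List (Subset b)} →
           Unique A → Unique B → Unique (A ⊗ B)
unique-⊗ = Unique.cartesianProductWith⁺ _++_ (λ {w} {x} → ++-injective w x)

-- Coordinatewise operations act blockwise, so closure passes to products.
closed-⊗ : ∀ {a b} f {A : List (Subset a)} {B : List (Subset b)} →
           ClosedUnder f A → ClosedUnder f B → ClosedUnder f (A ⊗ B)
closed-⊗ f {A} {B} closedA closedB S∈ T∈
  with ∈-cartesianProductWith⁻ _++_ A B S∈ | ∈-cartesianProductWith⁻ _++_ A B T∈
... | S₁ , S₂ , S₁∈ , S₂∈ , refl | T₁ , T₂ , T₁∈ , T₂∈ , refl =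
  subst (_∈ A ⊗ B) (sym (zipWith-++ f S₁ S₂ T₁ T₂))
    (∈-cartesianProductWith⁺ _++_ (closedA S₁∈ T₁∈) (closedB S₂∈ T₂∈))

++-⊆ : ∀ {a b} {T₁ Y₁ : Subset a} {T₂ Y₂ : Subset b} →
       T₁ ⊆ Y₁ → T₂ ⊆ Y₂ → T₁ ++ T₂ ⊆ Y₁ ++ Y₂
++-⊆ {T₁ = []ᵥ}            {[]ᵥ}            _ q = q
++-⊆ {T₁ = outside ∷ᵥ T₁}  {_ ∷ᵥ Y₁}        p q = out⊆ (++-⊆ (drop-∷-⊆ p) q)
++-⊆ {T₁ = inside ∷ᵥ T₁}   {outside ∷ᵥ Y₁}  p q with p Vec.here
... | ()
++-⊆ {T₁ = inside ∷ᵥ T₁}   {inside ∷ᵥ Y₁}   p q = s⊆s (++-⊆ (drop-∷-⊆ p) q)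

∣++∣ : ∀ {a b} (Y₁ : Subset a) (Y₂ : Subset b) → ∣ Y₁ ++ Y₂ ∣ ≡ ∣ Y₁ ∣ + ∣ Y₂ ∣
∣++∣ []ᵥ             Y₂ = refl
∣++∣ (outside ∷ᵥ Y₁) Y₂ = ∣++∣ Y₁ Y₂
∣++∣ (inside ∷ᵥ Y₁)  Y₂ = cong suc (∣++∣ Y₁ Y₂)

-- If A ⊗ B shatters Y₁ ⊎ Y₂ then A shatters Y₁ and B shatters Y₂: a trace
-- T ⊆ Y₁ (resp. T ⊆ Y₂) is the first (second) block of the trace T ⊎ ∅ (∅ ⊎ T).
module _ {a b} {A : List (Subset a)} {B : List (Subset b)} {Y₁ : Subset a} {Y₂ : Subset b}
         (shattered : Shattered (members (A ⊗ B)) (Y₁ ++ Y₂)) where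

  private
    trace-blocks : ∀ {T₁ T₂} → T₁ ⊆ Y₁ → T₂ ⊆ Y₂ →
      Σ _ λ S₁ → Σ _ λ S₂ → S₁ ∈ A × S₂ ∈ B × S₁ ∩ Y₁ ≡ T₁ × S₂ ∩ Y₂ ≡ T₂
    trace-blocks {T₁} {T₂} T₁⊆ T₂⊆ with shattered (T₁ ++ T₂) (++-⊆ T₁⊆ T₂⊆)
    ... | S , S∈ , trace with ∈-cartesianProductWith⁻ _++_ A B S∈
    ... | S₁ , S₂ , S₁∈ , S₂∈ , refl =
      let traces = ++-injective (S₁ ∩ Y₁) T₁ (trans (sym (zipWith-++ _∧_ S₁ S₂ Y₁ Y₂)) trace)
      in S₁ , S₂ , S₁∈ , S₂∈ , proj₁ traces , proj₂ traces

  shattered-⊗ˡ : Shattered (members A) Y₁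
  shattered-⊗ˡ T T⊆ =
    let (S₁ , _ , S₁∈ , _ , trace , _) = trace-blocks {T₂ = ⊥} T⊆ ⊥⊆ in S₁ , S₁∈ , trace

  shattered-⊗ʳ : Shattered (members B) Y₂
  shattered-⊗ʳ T T⊆ =
    let (_ , S₂ , _ , S₂∈ , _ , trace) = trace-blocks {T₁ = ⊥} ⊥⊆ T⊆ in S₂ , S₂∈ , trace

vc-⊗ : ∀ {a b} {A : List (Subset a)} {B : List (Subset b)} {d e} →
       VC≤ (members A) d → VC≤ (members B) e → VC≤ (members (A ⊗ B)) (d + e)
vc-⊗ {a} {A = A} {B} {d} {e} vcA vcB Y shattered with splitAt a Y
... | Y₁ , Y₂ , refl = subst (_≤ d + e) (sym (∣++∣ Y₁ Y₂))
  (+-mono-≤ (vcA Y₁ (shattered-⊗ˡ {A = A} {B} shattered)) (vcB Y₂ (shattered-⊗ʳ {A = A} {B} shattered)))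

sublattice-⊗ : ∀ {a b} {A : List (Subset a)} {B : List (Subset b)} {d e} →
               VCSublattice A d → VCSublattice B e → VCSublattice (A ⊗ B) (d + e)
sublattice-⊗ LA LB = record
  { unique  = unique-⊗ (unique LA) (unique LB)
  ; closed∩ = closed-⊗ _∧_ (closed∩ LA) (closed∩ LB)
  ; closed∪ = closed-⊗ _∨_ (closed∪ LA) (closed∪ LB)
  ; vc      = vc-⊗ (vc LA) (vc LB)
  }

point : ∀ r → List (Subset r)
point r = [ ⊥ ]

trace-of-⊥ : ∀ {r} {Y T : Subset r} → ⊥ ∩ Y ≡ T → ∣ T ∣ ≡ 0
trace-of-⊥ {r} {Y} refl = trans (cong ∣_∣ (∩-zeroˡ Y)) (∣⊥∣≡0 r)

sublattice-point : ∀ r → VCSublattice (point r) 0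
sublattice-point r = record
  { unique  = [] ∷ []
  ; closed∩ = λ { (here refl) (here refl) → here (∩-idem ⊥) }
  ; closed∪ = λ { (here refl) (here refl) → here (∪-idem ⊥) }
  ; vc      = λ Y shattered → case-trace (shattered Y ⊆-refl)
  }
  where
  case-trace : ∀ {Y} → Σ _ (λ S → S ∈ point r × S ∩ Y ≡ Y) → ∣ Y ∣ ≤ 0
  case-trace (_ , here refl , trace) = ≤-reflexive (trace-of-⊥ trace)

power : ∀ {q} (d : ℕ) → List (Subset q) → List (Subset (d * q))
power zero    A = point 0
power (suc d) A = A ⊗ power d A

length-power : ∀ {q} d (A : List (Subset q)) → length (power d A) ≡ length A ^ d
length-power zero    A = refl
length-power (suc d) A = trans (length-⊗ A (power d A)) (cong (length A *_) (length-power d A))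

sublattice-power : ∀ {q} {A : List (Subset q)} {k} d →
                   VCSublattice A k → VCSublattice (power d A) (d * k)
sublattice-power zero    LA = sublattice-point 0
sublattice-power (suc d) LA = sublattice-⊗ LA (sublattice-power d LA)

chain : (q : ℕ) → List (Subset q)
chain zero    = [ []ᵥ ]
chain (suc q) = ⊥ ∷ map (inside ∷ᵥ_) (chain q)

⊥∈chain : ∀ q → ⊥ ∈ chain q
⊥∈chain zero    = here refl
⊥∈chain (suc q) = here refl

length-chain : ∀ q → length (chain q) ≡ suc q
length-chain zero    = refl
length-chain (suc q) = cong suc (trans (length-map (inside ∷ᵥ_) (chain q)) (length-chain q))

unique-chain : ∀ q → Unique (chain q)
unique-chain zero    = [] ∷ []
unique-chain (suc q) = All.tabulate ⊥∉extended ∷ Unique.map⁺ ∷-injectiveʳ (unique-chain q)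
  where
  ⊥∉extended : ∀ {S} → S ∈ map (inside ∷ᵥ_) (chain q) → ⊥ ≢ S
  ⊥∉extended S∈ ⊥≡S with ∈-map⁻ (inside ∷ᵥ_) S∈
  ... | _ , _ , refl with ∷-injectiveˡ ⊥≡S
  ... | ()

closed∩-chain : ∀ q → ClosedUnder _∧_ (chain q)
closed∩-chain zero    (here refl) (here refl) = here refl
closed∩-chain (suc q) {T = T} (here refl) _ = here (∩-zeroˡ T)
closed∩-chain (suc q) {S = S} (there _) (here refl) = here (∩-zeroʳ S)
closed∩-chain (suc q) (there S∈) (there T∈)
  with ∈-map⁻ (inside ∷ᵥ_) S∈ | ∈-map⁻ (inside ∷ᵥ_) T∈
... | _ , S∈′ , refl | _ , T∈′ , refl = there (∈-map⁺ (inside ∷ᵥ_) (closed∩-chain q S∈′ T∈′))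

closed∪-chain : ∀ q → ClosedUnder _∨_ (chain q)
closed∪-chain zero    (here refl) (here refl) = here refl
closed∪-chain (suc q) {T = T} (here refl) T∈ = subst (_∈ chain (suc q)) (sym (∪-identityˡ T)) T∈
closed∪-chain (suc q) {S = S} (there S∈) (here refl) =
  subst (_∈ chain (suc q)) (sym (∪-identityʳ S)) (there S∈)
closed∪-chain (suc q) (there S∈) (there T∈)
  with ∈-map⁻ (inside ∷ᵥ_) S∈ | ∈-map⁻ (inside ∷ᵥ_) T∈
... | _ , S∈′ , refl | _ , T∈′ , refl = there (∈-map⁺ (inside ∷ᵥ_) (closed∪-chain q S∈′ T∈′))

-- If Y contains the first coordinate,
-- the trace "Y minus that coordinate" comes from a segment missing it, i.e. ∅,
-- so the rest of Y is empty; otherwise Y is shattered by the shorter chain.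
vc-chain : ∀ q → VC≤ (members (chain q)) 1
vc-chain zero    []ᵥ _ = z≤n
vc-chain (suc q) (outside ∷ᵥ Y) shattered = vc-chain q Y tail-shattered
  where
  tail-shattered : Shattered (members (chain q)) Y
  tail-shattered T T⊆ with shattered (outside ∷ᵥ T) (out⊆ T⊆)
  ... | _ , here refl , trace = ⊥ , ⊥∈chain q , ∷-injectiveʳ trace
  ... | _ , there S∈ , trace with ∈-map⁻ (inside ∷ᵥ_) S∈
  ... | S , S∈′ , refl = S , S∈′ , ∷-injectiveʳ trace
vc-chain (suc q) (inside ∷ᵥ Y) shattered with shattered (outside ∷ᵥ Y) (out⊆ ⊆-refl)
... | _ , here refl , trace = s≤s (≤-reflexive (trace-of-⊥ (∷-injectiveʳ trace)))
... | _ , there S∈ , trace with ∈-map⁻ (inside ∷ᵥ_) S∈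
... | _ , _ , refl with ∷-injectiveˡ trace
... | ()

sublattice-chain : ∀ q → VCSublattice (chain q) 1
sublattice-chain q = record
  { unique  = unique-chain q
  ; closed∩ = closed∩-chain q
  ; closed∪ = closed∪-chain q
  ; vc      = vc-chain q
  }

extremal : ∀ {n} d q r → n ≡ d * q + r →
  Σ (List (Subset n)) λ A → VCSublattice A d × length A ≡ suc q ^ d
extremal d q r refl =
  power d (chain q) ⊗ point r ,
  subst (VCSublattice _) (trans (+-identityʳ (d * 1)) (*-identityʳ d))
    (sublattice-⊗ (sublattice-power d (sublattice-chain q)) (sublattice-point r)) ,
  (begin
    length (power d (chain q) ⊗ point r)   ≡⟨ length-⊗ (power d (chain q)) (point r) ⟩
    length (power d (chain q)) * 1          ≡⟨ *-identityʳ _ ⟩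
    length (power d (chain q))              ≡⟨ length-power d (chain q) ⟩
    length (chain q) ^ d                    ≡⟨ cong (_^ d) (length-chain q) ⟩
    suc q ^ d                               ∎)
  where open ≡-Reasoning

^-distrib-* : ∀ a b k → (a * b) ^ k ≡ a ^ k * b ^ k
^-distrib-* a b zero    = refl
^-distrib-* a b (suc k) =
  trans (cong (a * b *_) (^-distrib-* a b k)) ([m*n]*[o*p]≡[m*o]*[n*p] a b (a ^ k) (b ^ k))

size-bound : ∀ {n} d q r .{{_ : NonZero d}} → n ≡ d * q + r → r < d → n ^ d < d ^ d * suc q ^ d
size-bound d q r refl r<d = subst ((d * q + r) ^ d <_) (^-distrib-* d (suc q) d) (^-monoˡ-< d n<d[q+1])
  where
  n<d[q+1] : d * q + r < d * suc q
  n<d[q+1] = subst (d * q + r <_) (trans (+-comm (d * q) d) (sym (*-suc d q))) (+-monoʳ-< (d * q) r<d)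

division : ∀ n d .{{_ : NonZero d}} → n ≡ d * (n / d) + n % d
division n d = trans (m≡m%n+[m/n]*n n d) (trans (+-comm (n % d) _) (cong (_+ n % d) (*-comm (n / d) d)))

proposition11 : (n d : ℕ) → 1 ≤ d → d ≤ n →
    Σ (List (Subset n)) λ A →
      Unique A ×
      VC≤ (members A ∩∩ members A) d ×
      VC≤ (members A ∪∪ members A) d ×
      n ^ d < d ^ d * length A
proposition11 n d@(suc _) _ _ with extremal d (n / d) (n % d) (division n d)
... | A , LA , |A|≡ =
  A , unique LA , vc-∩∩ LA , vc-∪∪ LA ,
  subst (λ m → n ^ d < d ^ d * m) (sym |A|≡) (size-bound d (n / d) (n % d) (division n d) (m%n<n n d))
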